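{- Let $D$ be a finite bicolored digraph in which every vertex has exactly one outgoing arc of color $1$, exactly one outgoing arc of color $2$, exactly one incoming arc of color $1$ and exactly one incoming arc of color $2$ (so that, for $i=1,2$, the spanning subdigraph with arc set $A_i(D)$ is a disjoint union of directed cycles). If $D$ has a bikernel, then there is a $k$ such that for both $i=1$ and $i=2$, $A_i(D)$ is a disjoint union of exactly $k$ directed cycles.
   Context: A bicolored digraph has each arc colored $1$ or $2$; $A_i(D)$ is the set of arcs of color $i$. A non-empty set $B\subseteq V(D)$ is a bikernel (by monochromatic paths) if: (i) for all distinct $u,v\in B$ there is no monochromatic directed $uv$-path; (ii) for every $v\in V(D)\setminus B$ there is a directed path of color $1$ from $v$ to a vertex of $B$; (iii) for every $v\in V(D)\setminus B$ there is a directed path of color $2$ from a vertex of $B$ to $v$. -}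

module Defs where

open import Data.Nat using (ℕ)
open import Data.Fin using (Fin; zero; suc; inject₁; fromℕ)
open import Data.Fin.Subset using (Subset; _∈_; _∉_; Nonempty)
open import Data.Bool using (Bool; true)
open import Data.Product using (Σ; ∃; ∃!; _×_; _,_)
open import Data.Sum using (_⊎_)
open import Relation.Nullary using (¬_)
open import Relation.Binary.PropositionalEquality using (_≡_)
open import Relation.Binary.Construct.Closure.Transitive using (TransClosure)
open import Function.Definitions using (Injective)

data Colour : Set where
  c₁ c₂ : Colour

-- A finite bicoloured digraph on the vertex set Fin n.
-- arc i u v ≡ true  means  (u , v) ∈ A_i(D).
record BicolouredDigraph (n : ℕ) : Set where
  field
    arc : Colour → Fin n → Fin n → Bool
    colours-disjoint : ∀ u v → arc c₁ u v ≡ true → ¬ (arc c₂ u v ≡ true)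
open BicolouredDigraph public

module _ {n : ℕ} (D : BicolouredDigraph n) where

  Arc : Colour → Fin n → Fin n → Set
  Arc i u v = arc D i u v ≡ true

  MonoPath : Colour → Fin n → Fin n → Set
  MonoPath i = TransClosure (Arc i)

  OneInOneOut : Set
  OneInOneOut = ∀ (i : Colour) (u : Fin n) →
    ∃! _≡_ (λ v → Arc i u v) × ∃! _≡_ (λ w → Arc i w u)

  record IsBikernel (B : Subset n) : Set where
    field
      nonempty : Nonempty B
      independent : ∀ u v → u ∈ B → v ∈ B → ¬ (u ≡ v) →
        ¬ (MonoPath c₁ u v) × ¬ (MonoPath c₂ u v)
      absorbing₁ : ∀ v → v ∉ B → ∃ λ b → b ∈ B × MonoPath c₁ v b
      dominating₂ : ∀ v → v ∉ B → ∃ λ b → b ∈ B × MonoPath c₂ b v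

  HasBikernel : Set
  HasBikernel = ∃ IsBikernel

  record DiCycle (i : Colour) : Set where
    field
      len   : ℕ
      verts : Fin (ℕ.suc len) → Fin n
      distinct : Injective _≡_ _≡_ verts
      arcs  : ∀ (j : Fin len) → Arc i (verts (inject₁ j)) (verts (suc j))
      close : Arc i (verts (fromℕ len)) (verts zero)
  open DiCycle public

  CycleArc : ∀ {i} → DiCycle i → Fin n → Fin n → Set
  CycleArc C u v =
    (∃ λ (j : Fin (len C)) → verts C (inject₁ j) ≡ u × verts C (suc j) ≡ v)
    ⊎ (verts C (fromℕ (len C)) ≡ u × verts C zero ≡ v)

  record DisjointUnionOfCycles (i : Colour) (k : ℕ) : Set where
    field
      cycles : Fin k → DiCycle i
      covers  : ∀ v → ∃ λ c → ∃ λ j → verts (cycles c) j ≡ v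
      disjoint : ∀ c c' j j' → verts (cycles c) j ≡ verts (cycles c') j' →
        Σ (c ≡ c') (λ { _≡_.refl → j ≡ j' })
      allArcs : ∀ u v → Arc i u v → ∃ λ c → CycleArc (cycles c) u v

-- Each colour class is the graph of a permutation of the vertices, so its cycles
-- are the orbits of that permutation.  A bikernel B is a system of orbit
-- representatives for both permutations: by (ii), resp. (iii), every orbit of the
-- colour-1, resp. colour-2, permutation contains a vertex of B, and by (i) no orbit
-- contains two.  Hence both colour classes consist of exactly |B| cycles, the one
-- through b ∈ B being b, f b, …, fᵖ b for the least period p + 1 of b.
module Submission where

open import Defs
open import Level using (Level)
open import Data.Nat using (ℕ; zero; suc; _+_; _*_; _≤_; _<_; s≤s)
open import Data.Nat.Properties
  using (m≤n⇒∃[o]m+o≡n; m≤n+m; +-suc; +-comm; *-suc; <-≤-trans; <-cmp; n<1+n)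
  renaming (_≟_ to _ℕ≟_)
open import Data.Nat.DivMod using (_%_; _/_; m≡m%n+[m/n]*n; m%n<n)
open import Data.Nat.GeneralisedArithmetic using (fold; fold-+)
open import Data.Fin using (Fin; zero; suc; toℕ; fromℕ; fromℕ<; inject₁; lower₁; _≟_)
open import Data.Fin.Properties
  using ( pigeonhole; ¬∀⟶∃¬-smallest; toℕ-injective; toℕ≤pred[n]; toℕ-inject; toℕ-inject₁
        ; toℕ-fromℕ; toℕ-fromℕ<; inject₁-lower₁; suc-injective)
open import Data.Fin.Subset using (Subset; _∈_)
open import Data.Fin.Subset.Properties using (_∈?_)
open import Data.Product using (∃; _×_; _,_; proj₁; proj₂)
open import Data.Sum using (_⊎_; inj₁; inj₂)
open import Function using (_∘_)
open import Function.Definitions using (Injective)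
open import Relation.Nullary using (¬_; yes; no; ¬?; contradiction)
open import Relation.Nullary.Decidable using (decidable-stable)
open import Relation.Unary using (Pred; Decidable)
open import Relation.Binary.Definitions using (tri<; tri≈; tri>)
open import Relation.Binary.PropositionalEquality
open import Relation.Binary.Construct.Closure.Transitive using ([_]; _∷_; _∷ʳ_)

private
  variable
    a ℓ : Level
    A : Set a
    n : ℕ

record Enumeration (P : Pred (Fin n) ℓ) : Set ℓ where
  field
    size            : ℕ
    elem            : Fin size → Fin n
    elem-injective  : Injective _≡_ _≡_ elem
    elem-satisfies  : ∀ c → P (elem c)
    elem-surjective : ∀ {x} → P x → ∃ λ c → elem c ≡ x
open Enumeration

include-zero : {P : Pred (Fin (suc n)) ℓ} → P zero → Enumeration (P ∘ suc) → Enumeration P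
include-zero P0 E .size = suc (size E)
include-zero P0 E .elem zero    = zero
include-zero P0 E .elem (suc c) = suc (elem E c)
include-zero P0 E .elem-injective {zero}  {zero}  _  = refl
include-zero P0 E .elem-injective {suc c} {suc d} eq = cong suc (elem-injective E (suc-injective eq))
include-zero P0 E .elem-satisfies zero    = P0
include-zero P0 E .elem-satisfies (suc c) = elem-satisfies E c
include-zero P0 E .elem-surjective {zero}  _  = zero , refl
include-zero P0 E .elem-surjective {suc x} Px =
  let c , eq = elem-surjective E Px in suc c , cong suc eq

exclude-zero : {P : Pred (Fin (suc n)) ℓ} → ¬ P zero → Enumeration (P ∘ suc) → Enumeration P
exclude-zero ¬P0 E .size = size E
exclude-zero ¬P0 E .elem = suc ∘ elem E
exclude-zero ¬P0 E .elem-injective = elem-injective E ∘ suc-injective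
exclude-zero ¬P0 E .elem-satisfies = elem-satisfies E
exclude-zero ¬P0 E .elem-surjective {zero}  P0 = contradiction P0 ¬P0
exclude-zero ¬P0 E .elem-surjective {suc x} Px =
  let c , eq = elem-surjective E Px in c , cong suc eq

enumerate : {P : Pred (Fin n) ℓ} → Decidable P → Enumeration P
enumerate {zero} P? .size = 0
enumerate {zero} P? .elem ()
enumerate {zero} P? .elem-injective {()}
enumerate {zero} P? .elem-satisfies ()
enumerate {zero} P? .elem-surjective {()}
enumerate {suc n} P? with P? zero
... | yes P0 = include-zero P0 (enumerate (P? ∘ suc))
... | no ¬P0 = exclude-zero ¬P0 (enumerate (P? ∘ suc))

_^_ : (A → A) → ℕ → A → A
(f ^ m) x = fold x f m

_↝[_]_ : {A : Set a} → A → (A → A) → A → Set a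
x ↝[ f ] y = ∃ λ j → (f ^ j) x ≡ y

module _ (f : A → A) where
  open ≡-Reasoning

  ^-+ : ∀ m k x → (f ^ (m + k)) x ≡ (f ^ m) ((f ^ k) x)
  ^-+ m k x = fold-+ x f m

  ↝-trans : ∀ {x y z} → x ↝[ f ] y → y ↝[ f ] z → x ↝[ f ] z
  ↝-trans {x} (j , refl) (k , refl) = k + j , ^-+ k j x

  ^-*-fixed : ∀ {p x} → (f ^ suc p) x ≡ x → ∀ t → (f ^ (t * suc p)) x ≡ x
  ^-*-fixed returns zero = refl
  ^-*-fixed {p} {x} returns (suc t) = begin
    (f ^ (suc p + t * suc p)) x        ≡⟨ ^-+ (suc p) (t * suc p) x ⟩
    (f ^ suc p) ((f ^ (t * suc p)) x)  ≡⟨ cong (f ^ suc p) (^-*-fixed returns t) ⟩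
    (f ^ suc p) x                      ≡⟨ returns ⟩
    x                                  ∎

  ^-%-fixed : ∀ {p x} → (f ^ suc p) x ≡ x → ∀ j → (f ^ (j % suc p)) x ≡ (f ^ j) x
  ^-%-fixed {p} {x} returns j = sym (begin
    (f ^ j) x
      ≡⟨ cong (λ e → (f ^ e) x) (m≡m%n+[m/n]*n j (suc p)) ⟩
    (f ^ (j % suc p + j / suc p * suc p)) x
      ≡⟨ ^-+ (j % suc p) _ x ⟩
    (f ^ (j % suc p)) ((f ^ (j / suc p * suc p)) x)
      ≡⟨ cong (f ^ (j % suc p)) (^-*-fixed returns (j / suc p)) ⟩
    (f ^ (j % suc p)) x
      ∎)

module Orbit {f : Fin n → Fin n} (f-injective : Injective _≡_ _≡_ f) where
  open ≡-Reasoning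

  ^-injective : ∀ m → Injective _≡_ _≡_ (f ^ m)
  ^-injective zero    eq = eq
  ^-injective (suc m) eq = ^-injective m (f-injective eq)

  repeat⇒return : ∀ {i j} x → i < j → (f ^ i) x ≡ (f ^ j) x →
                  ∃ λ o → o < j × (f ^ suc o) x ≡ x
  repeat⇒return {i} x i<j eq with o , refl ← m≤n⇒∃[o]m+o≡n i<j =
    o , s≤s (m≤n+m o i) , ^-injective i (begin
      (f ^ i) ((f ^ suc o) x)  ≡⟨ ^-+ f i (suc o) x ⟨
      (f ^ (i + suc o)) x      ≡⟨ cong (λ e → (f ^ e) x) (+-suc i o) ⟩
      (f ^ suc (i + o)) x      ≡⟨ eq ⟨
      (f ^ i) x                ∎)

  eventually-returns : ∀ x → ∃ λ o → o < n × (f ^ suc o) x ≡ x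
  eventually-returns x
    with i , j , i<j , eq ← pigeonhole (n<1+n n) (λ k → (f ^ toℕ k) x)
    with o , o<j , returns ← repeat⇒return x i<j eq =
    o , <-≤-trans o<j (toℕ≤pred[n] j) , returns

  record Period (x : Fin n) : Set where
    field
      p         : ℕ
      returns   : (f ^ suc p) x ≡ x
      minimal   : ∀ {q} → q < p → (f ^ suc q) x ≢ x

  -- Opaque, so that conversion checking never runs the pigeonhole search.
  opaque
    period : ∀ x → Period x
    period x
      with o , o<n , o-returns ← eventually-returns x
      with r , ¬¬returns , earlier ←
        ¬∀⟶∃¬-smallest n (λ q → (f ^ suc (toℕ q)) x ≢ x) (λ q → ¬? (_ ≟ _))
          (λ never → never (fromℕ< o<n)
            (subst (λ e → (f ^ suc e) x ≡ x) (sym (toℕ-fromℕ< o<n)) o-returns)) =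
      record { p = toℕ r ; returns = decidable-stable (_ ≟ _) ¬¬returns ; minimal = minimal }
      where
        minimal : ∀ {q} → q < toℕ r → (f ^ suc q) x ≢ x
        minimal q<r = subst (λ e → (f ^ suc e) x ≢ x)
          (trans (toℕ-inject (fromℕ< q<r)) (toℕ-fromℕ< q<r)) (earlier (fromℕ< q<r))

  module _ {x : Fin n} (P : Period x) where
    open Period P

    no-repeat-within-period : ∀ {i j} → i < j → j ≤ p → (f ^ i) x ≢ (f ^ j) x
    no-repeat-within-period i<j j≤p eq with o , o<j , returns ← repeat⇒return x i<j eq =
      minimal (<-≤-trans o<j j≤p) returns

    ^-injective-within-period : ∀ {i j} → i ≤ p → j ≤ p → (f ^ i) x ≡ (f ^ j) x → i ≡ j
    ^-injective-within-period {i} {j} i≤p j≤p eq with <-cmp i j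
    ... | tri< i<j _ _ = contradiction eq (no-repeat-within-period i<j j≤p)
    ... | tri≈ _ i≡j _ = i≡j
    ... | tri> _ _ j<i = contradiction (sym eq) (no-repeat-within-period j<i i≤p)

  ↝-sym : ∀ {x y} → x ↝[ f ] y → y ↝[ f ] x
  ↝-sym {x} (j , refl) = j * p , (begin
      (f ^ (j * p)) ((f ^ j) x)  ≡⟨ ^-+ f (j * p) j x ⟨
      (f ^ (j * p + j)) x        ≡⟨ cong (λ e → (f ^ e) x) (trans (+-comm (j * p) j) (sym (*-suc j p))) ⟩
      (f ^ (j * suc p)) x        ≡⟨ ^-*-fixed f returns j ⟩
      x                          ∎)
    where open Period (period x)

fromℕ-or-inject₁ : ∀ {m} (t : Fin (suc m)) → t ≡ fromℕ m ⊎ ∃ λ t′ → inject₁ t′ ≡ t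
fromℕ-or-inject₁ {m} t with m ℕ≟ toℕ t
... | yes m≡t = inj₁ (toℕ-injective (trans (sym m≡t) (sym (toℕ-fromℕ m))))
... | no m≢t  = inj₂ (lower₁ t m≢t , inject₁-lower₁ t m≢t)

module CycleDecomposition (D : BicolouredDigraph n) (i : Colour)
  {f : Fin n → Fin n} (f-injective : Injective _≡_ _≡_ f)
  (arc-f : ∀ u → Arc D i u (f u)) (arc⇒f : ∀ {u v} → Arc D i u v → f u ≡ v) where
  open Orbit f-injective

  orbitCycle : Fin n → DiCycle D i
  orbitCycle x = record
    { len      = p
    ; verts    = λ t → (f ^ toℕ t) x
    ; distinct = λ {s} {t} eq → toℕ-injective
        (^-injective-within-period (period x) (toℕ≤pred[n] s) (toℕ≤pred[n] t) eq)
    ; arcs     = λ t → subst (λ e → Arc D i ((f ^ e) x) (f ((f ^ toℕ t) x)))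
        (sym (toℕ-inject₁ t)) (arc-f _)
    ; close    = subst₂ (Arc D i) (cong (λ e → (f ^ e) x) (sym (toℕ-fromℕ p))) returns (arc-f _)
    }
    where open Period (period x)

  reachable⇒onOrbitCycle : ∀ {x y} → x ↝[ f ] y → ∃ λ t → verts (orbitCycle x) t ≡ y
  reachable⇒onOrbitCycle {x} (j , reach) =
    fromℕ< j%<p , trans (cong (λ e → (f ^ e) x) (toℕ-fromℕ< j%<p)) (trans (^-%-fixed f returns j) reach)
    where
      open Period (period x)
      j%<p : j % suc p < suc p
      j%<p = m%n<n j (suc p)

  orbitCycle-arc : ∀ x t → CycleArc D (orbitCycle x) (verts (orbitCycle x) t) (f (verts (orbitCycle x) t))
  orbitCycle-arc x t with fromℕ-or-inject₁ t
  ... | inj₁ refl        =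
    inj₂ (refl , sym (subst (λ e → f ((f ^ e) x) ≡ x) (sym (toℕ-fromℕ p)) returns))
    where open Period (period x)
  ... | inj₂ (t′ , refl) = inj₁ (t′ , refl , cong (λ e → f ((f ^ e) x)) (sym (toℕ-inject₁ t′)))

  module _ {P : Pred (Fin n) ℓ} (E : Enumeration P)
    (meets : ∀ v → ∃ λ b → P b × b ↝[ f ] v)
    (meets-once : ∀ {b b′} → P b → P b′ → b ↝[ f ] b′ → b ≡ b′) where

    cycle : Fin (size E) → DiCycle D i
    cycle = orbitCycle ∘ elem E

    covers-all : ∀ v → ∃ λ c → ∃ λ t → verts (cycle c) t ≡ v
    covers-all v with b , Pb , reach ← meets v with c , refl ← elem-surjective E Pb =
      c , reachable⇒onOrbitCycle reach

    cycleDecomposition : DisjointUnionOfCycles D i (size E)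
    cycleDecomposition .DisjointUnionOfCycles.cycles = cycle
    cycleDecomposition .DisjointUnionOfCycles.covers = covers-all
    cycleDecomposition .DisjointUnionOfCycles.disjoint c c′ t t′ eq
      with refl ← elem-injective E (meets-once (elem-satisfies E c) (elem-satisfies E c′)
                    (↝-trans f (toℕ t , eq) (↝-sym (toℕ t′ , refl)))) =
      refl , distinct (cycle c) eq
    cycleDecomposition .DisjointUnionOfCycles.allArcs u v uv with c , t , refl ← covers-all u =
      c , subst (CycleArc D (cycle c) u) (arc⇒f uv) (orbitCycle-arc (elem E c) t)

module Successor (D : BicolouredDigraph n) (one-in-one-out : OneInOneOut D) (i : Colour) where

  next : Fin n → Fin n
  next u = proj₁ (proj₁ (one-in-one-out i u))

  next-arc : ∀ u → Arc D i u (next u)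
  next-arc u = proj₁ (proj₂ (proj₁ (one-in-one-out i u)))

  arc⇒next : ∀ {u v} → Arc D i u v → next u ≡ v
  arc⇒next {u} = proj₂ (proj₂ (proj₁ (one-in-one-out i u)))

  prev : Fin n → Fin n
  prev v = proj₁ (proj₂ (one-in-one-out i v))

  arc⇒prev : ∀ {u v} → Arc D i u v → prev v ≡ u
  arc⇒prev {v = v} = proj₂ (proj₂ (proj₂ (one-in-one-out i v)))

  next-injective : Injective _≡_ _≡_ next
  next-injective {u} {w} eq =
    trans (sym (arc⇒prev (next-arc u))) (arc⇒prev (subst (Arc D i w) (sym eq) (next-arc w)))

  path⇒↝ : ∀ {u v} → MonoPath D i u v → u ↝[ next ] v
  path⇒↝ [ uv ]    = 1 , arc⇒next uv
  path⇒↝ (uw ∷ wv) = ↝-trans next (1 , arc⇒next uw) (path⇒↝ wv)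

  ↝⇒≡⊎path : ∀ {u v} → u ↝[ next ] v → u ≡ v ⊎ MonoPath D i u v
  ↝⇒≡⊎path (zero , u≡v) = inj₁ u≡v
  ↝⇒≡⊎path {u} (suc j , refl) with ↝⇒≡⊎path {u} (j , refl)
  ... | inj₁ u≡w  = inj₂ [ subst (λ w → Arc D i w (next ((next ^ j) u))) (sym u≡w) (next-arc _) ]
  ... | inj₂ path = inj₂ (path ∷ʳ next-arc _)

module Bikernel (D : BicolouredDigraph n) (one-in-one-out : OneInOneOut D)
  {B : Subset n} (bikernel : IsBikernel D B) where
  open IsBikernel bikernel
  open Successor D one-in-one-out

  no-monochromatic-path : ∀ i {b b′} → b ∈ B → b′ ∈ B → b ≢ b′ → ¬ MonoPath D i b b′
  no-monochromatic-path c₁ b∈B b′∈B b≢b′ = proj₁ (independent _ _ b∈B b′∈B b≢b′)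
  no-monochromatic-path c₂ b∈B b′∈B b≢b′ = proj₂ (independent _ _ b∈B b′∈B b≢b′)

  meets-once : ∀ i {b b′} → b ∈ B → b′ ∈ B → b ↝[ next i ] b′ → b ≡ b′
  meets-once i b∈B b′∈B reach with ↝⇒≡⊎path i reach
  ... | inj₁ b≡b′ = b≡b′
  ... | inj₂ path = decidable-stable (_ ≟ _) (λ b≢b′ → no-monochromatic-path i b∈B b′∈B b≢b′ path)

  meets₁ : ∀ v → ∃ λ b → b ∈ B × b ↝[ next c₁ ] v
  meets₁ v with v ∈? B
  ... | yes v∈B = v , v∈B , 0 , refl
  ... | no v∉B with b , b∈B , path ← absorbing₁ v v∉B =
    b , b∈B , Orbit.↝-sym (next-injective c₁) (path⇒↝ c₁ path)

  meets₂ : ∀ v → ∃ λ b → b ∈ B × b ↝[ next c₂ ] v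
  meets₂ v with v ∈? B
  ... | yes v∈B = v , v∈B , 0 , refl
  ... | no v∉B with b , b∈B , path ← dominating₂ v v∉B = b , b∈B , path⇒↝ c₂ path

mainTheorem4 : ∀ (n : ℕ) (D : BicolouredDigraph n) →
    OneInOneOut D → HasBikernel D →
    ∃ λ (k : ℕ) → DisjointUnionOfCycles D c₁ k × DisjointUnionOfCycles D c₂ k
mainTheorem4 n D one-in-one-out (B , bikernel) =
  size E , decomposition c₁ meets₁ , decomposition c₂ meets₂
  where
    open Successor D one-in-one-out
    open Bikernel D one-in-one-out bikernel
    E : Enumeration (_∈ B)
    E = enumerate (_∈? B)

    decomposition : ∀ i → (∀ v → ∃ λ b → b ∈ B × b ↝[ next i ] v) →
                    DisjointUnionOfCycles D i (size E)
    decomposition i meets = CycleDecomposition.cycleDecomposition D i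
      (next-injective i) (next-arc i) (arc⇒next i) E meets (meets-once i)
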